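{- For $n\ge 5$, let $H_n$ be the graph with vertex set $\{v_1,\dots,v_n\}$ and edge set $\{v_iv_j : 1\le i\le n-3,\ i+1\le j\le n-1\}\cup\{v_{n-1}v_n\}$. Then $H_n$ is $(n-1)$-critical.
   Context: A star coloring of a graph $G$ is a proper vertex-coloring such that no path on four vertices (as a subgraph) is colored with only two colors; $\chi_s(G)$ is the minimum number of colors in a star coloring of $G$. $G$ is $k$-critical if $\chi_s(G)=k$ and $\chi_s(G-e)<\chi_s(G)$ for every edge $e\in E(G)$, where $G-e$ denotes deletion of the edge $e$. -}

module Defs where

open import Data.Nat using (ℕ; _+_; _<_; _≤_)
open import Data.Fin using (Fin; toℕ)
open import Data.Product using (_×_; ∃-syntax; Σ-syntax)
open import Data.Sum using (_⊎_)
open import Relation.Nullary using (¬_)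
open import Relation.Binary.PropositionalEquality using (_≡_; _≢_)

-- A graph on the vertex set Fin n, given by its adjacency relation.
-- (All graphs considered here are simple: H n below is symmetric and loopless,
-- and edge deletion preserves this.)
record Graph (n : ℕ) : Set₁ where
  field
    Adj : Fin n → Fin n → Set
open Graph public

_-edge_ : ∀ {n} → Graph n → Fin n × Fin n → Graph n
Adj (G -edge (x Data.Product., y)) u v =
  Adj G u v × ¬ ((u ≡ x × v ≡ y) ⊎ (u ≡ y × v ≡ x))

Coloring : ℕ → ℕ → Set
Coloring n k = Fin n → Fin k

Proper : ∀ {n k} → Graph n → Coloring n k → Set
Proper G c = ∀ u v → Adj G u v → c u ≢ c v

IsP4 : ∀ {n} → Graph n → Fin n → Fin n → Fin n → Fin n → Set
IsP4 G a b c d =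
  (a ≢ b × a ≢ c × a ≢ d × b ≢ c × b ≢ d × c ≢ d) ×
  (Adj G a b × Adj G b c × Adj G c d)

TwoColoured : ∀ {n k} → Coloring n k → Fin n → Fin n → Fin n → Fin n → Set
TwoColoured {k = k} col a b c d =
  ∃[ x ] ∃[ y ] (In x y (col a) × In x y (col b) × In x y (col c) × In x y (col d))
  where
  In : Fin k → Fin k → Fin k → Set
  In x y z = z ≡ x ⊎ z ≡ y

StarColoring : ∀ {n k} → Graph n → Coloring n k → Set
StarColoring G col =
  Proper G col ×
  (∀ a b c d → IsP4 G a b c d → ¬ TwoColoured col a b c d)

StarColorable : ∀ {n} → Graph n → ℕ → Set
StarColorable {n} G k = Σ[ col ∈ Coloring n k ] StarColoring G col

StarChromatic : ∀ {n} → Graph n → ℕ → Set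
StarChromatic G k = StarColorable G k × (∀ m → m < k → ¬ StarColorable G m)

Critical : ∀ {n} → Graph n → ℕ → Set
Critical G k =
  StarChromatic G k ×
  (∀ x y → Adj G x y → ∃[ m ] (m < k × StarChromatic (G -edge (x Data.Product., y)) m))

-- H_n, with v_i represented by the vertex i-1 : Fin n.
-- 1-based edges v_i v_j with 1 ≤ i ≤ n-3, i+1 ≤ j ≤ n-1, and v_{n-1} v_n.
-- 0-based: a < b, a ≤ n-4, b ≤ n-2; or a = n-2, b = n-1.
HEdge : (n : ℕ) → Fin n → Fin n → Set
HEdge n a b =
  (toℕ a < toℕ b × toℕ a + 4 ≤ n × toℕ b + 2 ≤ n) ⊎
  (toℕ a + 2 ≡ n × toℕ b + 1 ≡ n)

H : (n : ℕ) → Graph n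
Adj (H n) a b = HEdge n a b ⊎ HEdge n b a

{-# OPTIONS --safe #-}
-- Number the vertices of H from 0. Then H (5 + m) is a clique K = {0, …, 1 + m}, two vertices
-- u = 2 + m and w = 3 + m joined to all of K but not to each other, and a pendant vertex z = 4 + m
-- at w. The upper bounds are explicit colourings whose non-singleton colour classes are
-- independent and such that no vertex of one class sees two vertices of another; such a proper
-- colouring has no bicoloured P₄. The lower bounds are pigeonhole arguments on near-cliques: with
-- too few colours, a vertex set that is a clique except for one missing pair repeats a colour on
-- that pair. In H this forces c u = c w, and then the path u x w z keeps the colour of z off K;
-- in H minus an edge p q inside K it forces c p = c q and c u = c w, making p u q w bicoloured.
module Submission where

open import Defs
open import Data.Nat using (ℕ; _≤_; _∸_; zero; suc; _+_; _<_; z≤n; s≤s; _≟_)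
open import Data.Nat.Properties
open import Data.Fin as Fin using (Fin; toℕ; fromℕ<)
open import Data.Fin.Properties
  using (toℕ-injective; toℕ<n; fromℕ<-injective; pigeonhole)
open import Data.Product as Product using (_×_; _,_; proj₁; proj₂)
open import Data.Sum as Sum using (_⊎_; inj₁; inj₂)
open import Data.Empty using (⊥; ⊥-elim)
open import Function using (_∘_)
open import Relation.Nullary using (¬_; yes; no)
open import Relation.Nullary.Decidable using (decidable-stable)
open import Relation.Binary.PropositionalEquality

≢-same-≡ : ∀ {A : Set} {x y p q r : A} →
  (p ≡ x ⊎ p ≡ y) → (q ≡ x ⊎ q ≡ y) → (r ≡ x ⊎ r ≡ y) → p ≢ q → r ≢ q → p ≡ r
≢-same-≡ (inj₁ refl) (inj₁ refl) _           p≢q _   = ⊥-elim (p≢q refl)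
≢-same-≡ (inj₂ refl) (inj₂ refl) _           p≢q _   = ⊥-elim (p≢q refl)
≢-same-≡ _           (inj₁ refl) (inj₁ refl) _   r≢q = ⊥-elim (r≢q refl)
≢-same-≡ _           (inj₂ refl) (inj₂ refl) _   r≢q = ⊥-elim (r≢q refl)
≢-same-≡ (inj₁ refl) (inj₂ refl) (inj₁ refl) _   _   = refl
≢-same-≡ (inj₂ refl) (inj₁ refl) (inj₂ refl) _   _   = refl

twoColoured-alternates : ∀ {n k} {G : Graph n} {col : Coloring n k} {a b c d} →
  Proper G col → Adj G a b → Adj G b c → Adj G c d →
  TwoColoured col a b c d → col a ≡ col c × col b ≡ col d
twoColoured-alternates proper ab bc cd (_ , _ , ∈a , ∈b , ∈c , ∈d) =
  ≢-same-≡ ∈a ∈b ∈c (proper _ _ ab) (proper _ _ bc ∘ sym) ,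
  ≢-same-≡ ∈b ∈c ∈d (proper _ _ bc) (proper _ _ cd ∘ sym)

SameEdge : ∀ {A : Set} → A → A → A → A → Set
SameEdge p q x y = (x ≡ p × y ≡ q) ⊎ (x ≡ q × y ≡ p)

sameEdge-map : ∀ {A B : Set} (f : A → B) {p q x y} →
  SameEdge p q x y → SameEdge (f p) (f q) (f x) (f y)
sameEdge-map f (inj₁ (x≡p , y≡q)) = inj₁ (cong f x≡p , cong f y≡q)
sameEdge-map f (inj₂ (x≡q , y≡p)) = inj₂ (cong f x≡q , cong f y≡p)

sameEdge-toℕ⁻¹ : ∀ {n} {p q x y : Fin n} →
  SameEdge (toℕ p) (toℕ q) (toℕ x) (toℕ y) → SameEdge p q x y
sameEdge-toℕ⁻¹ (inj₁ (x≡p , y≡q)) = inj₁ (toℕ-injective x≡p , toℕ-injective y≡q)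
sameEdge-toℕ⁻¹ (inj₂ (x≡q , y≡p)) = inj₂ (toℕ-injective x≡q , toℕ-injective y≡p)

sameEdge-sym : ∀ {A : Set} {p q x y : A} → SameEdge p q x y → SameEdge q p x y
sameEdge-sym = Sum.swap

¬SameEdge-avoidingʳ : ∀ {A : Set} {p q x y : A} → x ≢ q → y ≢ q → ¬ SameEdge p q x y
¬SameEdge-avoidingʳ _   y≢q (inj₁ (_ , y≡q)) = y≢q y≡q
¬SameEdge-avoidingʳ x≢q _   (inj₂ (x≡q , _)) = x≢q x≡q

¬SameEdge-avoidingˡ : ∀ {A : Set} {p q x y : A} → x ≢ p → y ≢ p → ¬ SameEdge p q x y
¬SameEdge-avoidingˡ x≢p y≢p = ¬SameEdge-avoidingʳ x≢p y≢p ∘ sameEdge-sym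

Without : (ℕ → ℕ → Set) → ℕ → ℕ → ℕ → ℕ → Set
Without R p q x y = R x y × ¬ SameEdge p q x y

without-swap : ∀ {R p q x y} → Without R p q x y → Without R q p x y
without-swap (r , ¬same) = r , ¬same ∘ sameEdge-sym

record Represents {n} (G : Graph n) (R : ℕ → ℕ → Set) : Set where
  field
    to      : ∀ {a b} → Adj G a b → R (toℕ a) (toℕ b)
    from    : ∀ {a b} → R (toℕ a) (toℕ b) → Adj G a b
    bounded : ∀ {x y} → R x y → x < n × y < n
open Represents

represents-resp : ∀ {n} {G : Graph n} {R R′ : ℕ → ℕ → Set} → Represents G R →
  (∀ {x y} → R x y → R′ x y) → (∀ {x y} → R′ x y → R x y) → Represents G R′
represents-resp rep R⇒R′ R′⇒R = record
  { to = R⇒R′ ∘ to rep ; from = from rep ∘ R′⇒R ; bounded = bounded rep ∘ R′⇒R }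

without-represented : ∀ {n} {G : Graph n} {R} → Represents G R →
  ∀ a b → Represents (G -edge (a , b)) (Without R (toℕ a) (toℕ b))
without-represented rep a b = record
  { to      = λ (ab , ¬same) → to rep ab , ¬same ∘ sameEdge-toℕ⁻¹
  ; from    = λ (r , ¬same) → from rep r , ¬same ∘ sameEdge-map toℕ
  ; bounded = bounded rep ∘ proj₁
  }

record IsStarColouringℕ {C : Set} (R : ℕ → ℕ → Set) (f : ℕ → C) : Set where
  field
    proper           : ∀ {x y} → R x y → f x ≢ f y
    noBicolouredPath : ∀ {a b c d} → R a b → R b c → R c d →
                       a ≢ c → b ≢ d → f a ≡ f c → f b ≡ f d → ⊥

starColorable-fromℕ : ∀ {n k} {G : Graph n} {R} → Represents G R →
  (f : ℕ → ℕ) → (∀ {x} → x < n → f x < k) → IsStarColouringℕ R f → StarColorable G k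
starColorable-fromℕ {n} {k} {G} rep f f<k isStar = col , proper , star
  where
  open IsStarColouringℕ isStar using (noBicolouredPath)

  col : Coloring n k
  col a = fromℕ< (f<k (toℕ<n a))

  col-≡ : ∀ {a b} → col a ≡ col b → f (toℕ a) ≡ f (toℕ b)
  col-≡ = fromℕ<-injective _ _ _ _

  proper : Proper G col
  proper a b ab = IsStarColouringℕ.proper isStar (to rep ab) ∘ col-≡

  star : ∀ a b c d → IsP4 G a b c d → ¬ TwoColoured col a b c d
  star a b c d ((_ , a≢c , _ , _ , b≢d , _) , ab , bc , cd) twoColoured =
    let (ac , bd) = twoColoured-alternates proper ab bc cd twoColoured
    in  noBicolouredPath (to rep ab) (to rep bc) (to rep cd)
          (a≢c ∘ toℕ-injective) (b≢d ∘ toℕ-injective) (col-≡ ac) (col-≡ bd)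

clamp : ∀ K → ℕ → Fin (suc K)
clamp K       zero    = Fin.zero
clamp zero    (suc x) = Fin.zero
clamp (suc K) (suc x) = Fin.suc (clamp K x)

toℕ-clamp : ∀ K {x} → x < suc K → toℕ (clamp K x) ≡ x
toℕ-clamp K       {zero}  _               = refl
toℕ-clamp (suc K) {suc x} (s≤s x<suc[K]) = cong suc (toℕ-clamp K x<suc[K])

restrictℕ : ∀ {K k} {G : Graph (suc K)} {R} → Represents G R →
  (col : Coloring (suc K) k) → StarColoring G col → IsStarColouringℕ R (col ∘ clamp K)
restrictℕ {K} {G = G} {R} rep col (proper , star) = record
  { proper = properℕ ; noBicolouredPath = pathℕ }
  where
  adj : ∀ {x y} → R x y → Adj G (clamp K x) (clamp K y)
  adj r = let (x<n , y<n) = bounded rep r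
          in  from rep (subst₂ R (sym (toℕ-clamp K x<n)) (sym (toℕ-clamp K y<n)) r)

  properℕ : ∀ {x y} → R x y → col (clamp K x) ≢ col (clamp K y)
  properℕ r = proper _ _ (adj r)

  clamp-≢ : ∀ {x y} → x < suc K → y < suc K → x ≢ y → clamp K x ≢ clamp K y
  clamp-≢ x<n y<n x≢y eq =
    x≢y (trans (sym (toℕ-clamp K x<n)) (trans (cong toℕ eq) (toℕ-clamp K y<n)))

  adj-≢ : ∀ {x y} → R x y → clamp K x ≢ clamp K y
  adj-≢ r = properℕ r ∘ cong col

  pathℕ : ∀ {a b c d} → R a b → R b c → R c d → a ≢ c → b ≢ d →
    col (clamp K a) ≡ col (clamp K c) → col (clamp K b) ≡ col (clamp K d) → ⊥
  pathℕ ab bc cd a≢c b≢d ac bd =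
    star _ _ _ _
      ( ( adj-≢ ab
        , clamp-≢ (proj₁ (bounded rep ab)) (proj₂ (bounded rep bc)) a≢c
        -- a = d would close the triangle a b c, whose ends a and c share a colour
        , (λ a≡d → properℕ cd (trans (sym ac) (cong col a≡d)))
        , adj-≢ bc
        , clamp-≢ (proj₁ (bounded rep bc)) (proj₂ (bounded rep cd)) b≢d
        , adj-≢ cd )
      , adj ab , adj bc , adj cd )
      (_ , _ , inj₁ refl , inj₂ refl , inj₁ (sym ac) , inj₂ (sym bd))

NeedsColours : (ℕ → ℕ → Set) → ℕ → Set
NeedsColours R s = ∀ {k} {f : ℕ → Fin k} → IsStarColouringℕ R f → s ≤ k

starChromatic : ∀ {K s} {G : Graph (suc K)} {R} → Represents G R →
  StarColorable G s → NeedsColours R s → StarChromatic G s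
starChromatic rep colourable needs =
  colourable , λ k k<s (col , star) → <⇒≱ k<s (needs (restrictℕ rep col star))

isStarColouringℕ-byClasses : ∀ {C : Set} {R : ℕ → ℕ → Set} (f : ℕ → C) (S T : ℕ → Set) →
  (∀ {x} → ¬ R x x) →
  (∀ {x y} → x ≢ y → f x ≡ f y → (S x × S y) ⊎ (T x × T y)) →
  (∀ {x y} → S x → S y → ¬ R x y) →
  (∀ {x y} → T x → T y → ¬ R x y) →
  (∀ {a b c} → S a → T b → S c → a ≢ c → R a b → R b c → ⊥) →
  IsStarColouringℕ R f
isStarColouringℕ-byClasses {R = R} f S T irrefl collision S-indep T-indep T-sees-one-S =
  record { proper = proper ; noBicolouredPath = path }
  where
  proper : ∀ {x y} → R x y → f x ≢ f y
  proper {x} xy fx≡fy with collision (λ { refl → irrefl xy }) fx≡fy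
  ... | inj₁ (Sx , Sy) = S-indep Sx Sy xy
  ... | inj₂ (Tx , Ty) = T-indep Tx Ty xy

  path : ∀ {a b c d} → R a b → R b c → R c d → a ≢ c → b ≢ d → f a ≡ f c → f b ≡ f d → ⊥
  path ab bc cd a≢c b≢d ac bd with collision a≢c ac | collision b≢d bd
  ... | inj₁ (Sa , _)  | inj₁ (Sb , _)  = S-indep Sa Sb ab
  ... | inj₂ (Ta , _)  | inj₂ (Tb , _)  = T-indep Ta Tb ab
  ... | inj₁ (Sa , Sc) | inj₂ (Tb , _)  = T-sees-one-S Sa Tb Sc a≢c ab bc
  ... | inj₂ (_ , Tc)  | inj₁ (Sb , Sd) = T-sees-one-S Sb Tc Sd b≢d bc cd

isStarColouringℕ-byClass : ∀ {C : Set} {R : ℕ → ℕ → Set} (f : ℕ → C) (S : ℕ → Set) →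
  (∀ {x} → ¬ R x x) →
  (∀ {x y} → x ≢ y → f x ≡ f y → S x × S y) →
  (∀ {x y} → S x → S y → ¬ R x y) →
  IsStarColouringℕ R f
isStarColouringℕ-byClass f S irrefl collision S-indep =
  isStarColouringℕ-byClasses f S (λ _ → ⊥) irrefl (λ x≢y → inj₁ ∘ collision x≢y) S-indep
    (λ ()) (λ _ ())

pigeonholeℕ : ∀ {k s} → k < s → (f : ℕ → Fin k) →
  (∀ {i j} → i < j → j < s → f i ≢ f j) → ⊥
pigeonholeℕ k<s f injective =
  let (i , j , i<j , fi≡fj) = pigeonhole k<s (f ∘ toℕ)
  in  injective i<j (toℕ<n j) fi≡fj

replace : ℕ → ℕ → ℕ → ℕ
replace a b x with x ≟ a
... | yes _ = b
... | no  _ = x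

replace-injective : ∀ {C : Set} (f : ℕ → C) {a b s} →
  (∀ {x y} → x < y → y < s → x ≢ a → y ≢ a → f x ≢ f y) →
  (∀ {x} → x < s → x ≢ a → f x ≢ f b) →
  ∀ {i j} → i < j → j < s → f (replace a b i) ≢ f (replace a b j)
replace-injective f {a} kept new {i} {j} i<j j<s with i ≟ a | j ≟ a
... | yes refl | yes refl = ⊥-elim (<-irrefl refl i<j)
... | yes refl | no j≢a   = new j<s j≢a ∘ sym
... | no i≢a   | yes refl = new (<-trans i<j j<s) i≢a
... | no i≢a   | no j≢a   = kept i<j j<s i≢a j≢a

x+k≤k+y⇒x≤y : ∀ k {x y} → x + k ≤ k + y → x ≤ y
x+k≤k+y⇒x≤y k {x} {y} = +-cancelˡ-≤ k x y ∘ subst (_≤ k + y) (+-comm x k)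

x≤y⇒x+k≤k+y : ∀ k {x y} → x ≤ y → x + k ≤ k + y
x≤y⇒x+k≤k+y k {x} {y} = subst (_≤ k + y) (+-comm k x) ∘ +-monoʳ-≤ k

x+k≡k+y⇒x≡y : ∀ k {x y} → x + k ≡ k + y → x ≡ y
x+k≡k+y⇒x≡y k {x} {y} = +-cancelˡ-≡ k x y ∘ trans (+-comm k x)

x≡y⇒x+k≡k+y : ∀ k {x y} → x ≡ y → x + k ≡ k + y
x≡y⇒x+k≡k+y k {x} refl = +-comm x k

module _ (m : ℕ) where

  u w z : ℕ
  u = 2 + m
  w = 3 + m
  z = 4 + m

  u<w : u < w
  u<w = n<1+n u

  w<z : w < z
  w<z = n<1+n w

  u<z : u < z
  u<z = <-trans u<w w<z

  Edgeℕ : ℕ → ℕ → Set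
  Edgeℕ x y = (x < y × x ≤ 1 + m × y ≤ w) ⊎ (x ≡ w × y ≡ z)

  Adjℕ : ℕ → ℕ → Set
  Adjℕ x y = Edgeℕ x y ⊎ Edgeℕ y x

  Edgeℕ⇒< : ∀ {x y} → Edgeℕ x y → x < y
  Edgeℕ⇒< (inj₁ (x<y , _))     = x<y
  Edgeℕ⇒< (inj₂ (refl , refl)) = w<z

  Edgeℕ⇒≤z : ∀ {x y} → Edgeℕ x y → y ≤ z
  Edgeℕ⇒≤z (inj₁ (_ , _ , y≤w)) = m≤n⇒m≤1+n y≤w
  Edgeℕ⇒≤z (inj₂ (_ , refl))    = ≤-refl

  Edgeℕ-bounded : ∀ {x y} → Edgeℕ x y → x < 5 + m × y < 5 + m
  Edgeℕ-bounded e = <-trans (Edgeℕ⇒< e) (s≤s (Edgeℕ⇒≤z e)) , s≤s (Edgeℕ⇒≤z e)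

  H-represented : Represents (H (5 + m)) Adjℕ
  H-represented = record
    { to      = Sum.map edgeℕ edgeℕ
    ; from    = Sum.map hEdge hEdge
    ; bounded = λ { (inj₁ e) → Edgeℕ-bounded e ; (inj₂ e) → Product.swap (Edgeℕ-bounded e) }
    }
    where
    edgeℕ : ∀ {a b} → HEdge (5 + m) a b → Edgeℕ (toℕ a) (toℕ b)
    edgeℕ (inj₁ (a<b , a+4≤ , b+2≤)) = inj₁ (a<b , x+k≤k+y⇒x≤y 4 a+4≤ , x+k≤k+y⇒x≤y 2 b+2≤)
    edgeℕ (inj₂ (a+2≡ , b+1≡))       = inj₂ (x+k≡k+y⇒x≡y 2 a+2≡ , x+k≡k+y⇒x≡y 1 b+1≡)

    hEdge : ∀ {a b} → Edgeℕ (toℕ a) (toℕ b) → HEdge (5 + m) a b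
    hEdge (inj₁ (a<b , a≤ , b≤)) = inj₁ (a<b , x≤y⇒x+k≤k+y 4 a≤ , x≤y⇒x+k≤k+y 2 b≤)
    hEdge (inj₂ (a≡w , b≡z))     = inj₂ (x≡y⇒x+k≡k+y 2 a≡w , x≡y⇒x+k≡k+y 1 b≡z)

  Adjℕ-sym : ∀ {x y} → Adjℕ x y → Adjℕ y x
  Adjℕ-sym = Sum.swap

  Adjℕ-irrefl : ∀ {x} → ¬ Adjℕ x x
  Adjℕ-irrefl (inj₁ e) = <-irrefl refl (Edgeℕ⇒< e)
  Adjℕ-irrefl (inj₂ e) = <-irrefl refl (Edgeℕ⇒< e)

  Without-irrefl : ∀ {p q x} → ¬ Without Adjℕ p q x x
  Without-irrefl = Adjℕ-irrefl ∘ proj₁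

  below-w-adj : ∀ {x y} → x < y → y ≤ w → x ≢ u → Adjℕ x y
  below-w-adj x<y y≤w x≢u =
    inj₁ (inj₁ (x<y , ≤-pred (≤∧≢⇒< (≤-pred (<-≤-trans x<y y≤w)) x≢u) , y≤w))

  below-u-adj : ∀ {x y} → x < y → y ≤ u → Adjℕ x y
  below-u-adj x<y y≤u = below-w-adj x<y (m≤n⇒m≤1+n y≤u) (<⇒≢ (<-≤-trans x<y y≤u))

  adj-w-z : Adjℕ w z
  adj-w-z = inj₁ (inj₂ (refl , refl))

  ¬adj-u-w : ¬ Adjℕ u w
  ¬adj-u-w (inj₁ (inj₁ (_ , u≤1+m , _))) = n≮n (1 + m) u≤1+m
  ¬adj-u-w (inj₁ (inj₂ (u≡w , _)))       = <⇒≢ u<w u≡w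
  ¬adj-u-w (inj₂ (inj₁ (w<u , _)))       = <-asym w<u u<w
  ¬adj-u-w (inj₂ (inj₂ (_ , u≡z)))       = <⇒≢ u<z u≡z

  adj-z⇒w : ∀ {x} → Adjℕ x z → x ≡ w
  adj-z⇒w (inj₁ (inj₁ (_ , _ , z≤w)))   = ⊥-elim (n≮n w z≤w)
  adj-z⇒w (inj₁ (inj₂ (x≡w , _)))       = x≡w
  adj-z⇒w (inj₂ (inj₁ (z<x , _ , x≤w))) = ⊥-elim (<-asym (<-≤-trans z<x x≤w) w<z)
  adj-z⇒w (inj₂ (inj₂ (z≡w , _)))       = ⊥-elim (<⇒≢ w<z (sym z≡w))

  ¬adj-z : ∀ {x} → x ≤ u → ¬ Adjℕ x z
  ¬adj-z x≤u xz = n≮n u (subst (_≤ u) (adj-z⇒w xz) x≤u)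

  below-w : ∀ {x} → x < 5 + m → x ≢ w → x ≢ z → x < w
  below-w x<5+m x≢w x≢z = ≤∧≢⇒< (≤-pred (≤∧≢⇒< (≤-pred x<5+m) x≢z)) x≢w

  colourH : ℕ → ℕ
  colourH x with x ≟ w | x ≟ z
  ... | yes _ | _     = u
  ... | no _  | yes _ = w
  ... | no _  | no _  = x

  colourH<z : ∀ {x} → x < 5 + m → colourH x < z
  colourH<z {x} x<n with x ≟ w | x ≟ z
  ... | yes _   | _       = u<z
  ... | no _    | yes _   = w<z
  ... | no x≢w  | no x≢z  = <-trans (below-w x<n x≢w x≢z) w<z

  colourH-collision : ∀ {x y} → x ≢ y → colourH x ≡ colourH y →
    (x ≡ u ⊎ x ≡ w) × (y ≡ u ⊎ y ≡ w)
  colourH-collision {x} {y} x≢y eq with x ≟ w | x ≟ z | y ≟ w | y ≟ z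
  ... | yes refl | _        | yes refl | _        = ⊥-elim (x≢y refl)
  ... | yes refl | _        | no _     | yes refl = ⊥-elim (<⇒≢ u<w eq)
  ... | yes refl | _        | no _     | no _     = inj₂ refl , inj₁ (sym eq)
  ... | no _     | yes refl | yes refl | _        = ⊥-elim (<⇒≢ u<w (sym eq))
  ... | no _     | yes refl | no _     | yes refl = ⊥-elim (x≢y refl)
  ... | no _     | yes refl | no y≢w   | no _     = ⊥-elim (y≢w (sym eq))
  ... | no _     | no _     | yes refl | _        = inj₁ eq , inj₂ refl
  ... | no x≢w   | no _     | no _     | yes refl = ⊥-elim (x≢w eq)
  ... | no _     | no _     | no _     | no _     = ⊥-elim (x≢y eq)

  H-colourable : StarColorable (H (5 + m)) (4 + m)
  H-colourable = starColorable-fromℕ H-represented colourH colourH<z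
    (isStarColouringℕ-byClass colourH _ Adjℕ-irrefl colourH-collision independent)
    where
    independent : ∀ {x y} → (x ≡ u ⊎ x ≡ w) → (y ≡ u ⊎ y ≡ w) → ¬ Adjℕ x y
    independent (inj₁ refl) (inj₁ refl) = Adjℕ-irrefl
    independent (inj₁ refl) (inj₂ refl) = ¬adj-u-w
    independent (inj₂ refl) (inj₁ refl) = ¬adj-u-w ∘ Adjℕ-sym
    independent (inj₂ refl) (inj₂ refl) = Adjℕ-irrefl

  colour∖pq : ℕ → ℕ → ℕ → ℕ
  colour∖pq p q x with x ≟ q | x ≟ w | x ≟ z
  ... | yes _ | _     | _     = p
  ... | no _  | yes _ | _     = q
  ... | no _  | no _  | yes _ = p
  ... | no _  | no _  | no _  = x

  deletion∖pq-colourable : ∀ {p q} → p < q → q ≤ u →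
    ∀ {G : Graph (5 + m)} → Represents G (Without Adjℕ p q) → StarColorable G (3 + m)
  deletion∖pq-colourable {p} {q} p<q q≤u rep =
    starColorable-fromℕ rep (colour∖pq p q) colour<w
      (isStarColouringℕ-byClass (colour∖pq p q) _ Without-irrefl collision independent)
    where
    q<w : q < w
    q<w = ≤-<-trans q≤u u<w

    p<w : p < w
    p<w = <-trans p<q q<w

    p≤u : p ≤ u
    p≤u = <⇒≤ (<-≤-trans p<q q≤u)

    colour<w : ∀ {x} → x < 5 + m → colour∖pq p q x < w
    colour<w {x} x<n with x ≟ q | x ≟ w | x ≟ z
    ... | yes _ | _      | _      = p<w
    ... | no _  | yes _  | _      = q<w
    ... | no _  | no _   | yes _  = p<w
    ... | no _  | no x≢w | no x≢z = below-w x<n x≢w x≢z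

    collision : ∀ {x y} → x ≢ y → colour∖pq p q x ≡ colour∖pq p q y →
      (x ≡ p ⊎ x ≡ q ⊎ x ≡ z) × (y ≡ p ⊎ y ≡ q ⊎ y ≡ z)
    collision {x} {y} x≢y eq with x ≟ q | x ≟ w | x ≟ z | y ≟ q | y ≟ w | y ≟ z
    ... | yes refl | _        | _        | yes refl | _        | _        = ⊥-elim (x≢y refl)
    ... | yes refl | _        | _        | no _     | yes refl | _        = ⊥-elim (<⇒≢ p<q eq)
    ... | yes refl | _        | _        | no _     | no _     | yes refl = inj₂ (inj₁ refl) , inj₂ (inj₂ refl)
    ... | yes refl | _        | _        | no _     | no _     | no _     = inj₂ (inj₁ refl) , inj₁ (sym eq)
    ... | no _     | yes refl | _        | yes refl | _        | _        = ⊥-elim (<⇒≢ p<q (sym eq))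
    ... | no _     | yes refl | _        | no _     | yes refl | _        = ⊥-elim (x≢y refl)
    ... | no _     | yes refl | _        | no _     | no _     | yes refl = ⊥-elim (<⇒≢ p<q (sym eq))
    ... | no _     | yes refl | _        | no y≢q   | no _     | no _     = ⊥-elim (y≢q (sym eq))
    ... | no _     | no _     | yes refl | yes refl | _        | _        = inj₂ (inj₂ refl) , inj₂ (inj₁ refl)
    ... | no _     | no _     | yes refl | no _     | yes refl | _        = ⊥-elim (<⇒≢ p<q eq)
    ... | no _     | no _     | yes refl | no _     | no _     | yes refl = ⊥-elim (x≢y refl)
    ... | no _     | no _     | yes refl | no _     | no _     | no _     = inj₂ (inj₂ refl) , inj₁ (sym eq)
    ... | no _     | no _     | no _     | yes refl | _        | _        = inj₁ eq , inj₂ (inj₁ refl)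
    ... | no x≢q   | no _     | no _     | no _     | yes refl | _        = ⊥-elim (x≢q eq)
    ... | no _     | no _     | no _     | no _     | no _     | yes refl = inj₁ eq , inj₂ (inj₂ refl)
    ... | no _     | no _     | no _     | no _     | no _     | no _     = ⊥-elim (x≢y eq)

    independent : ∀ {x y} → (x ≡ p ⊎ x ≡ q ⊎ x ≡ z) → (y ≡ p ⊎ y ≡ q ⊎ y ≡ z) →
      ¬ Without Adjℕ p q x y
    independent (inj₁ refl)        (inj₁ refl)        = Without-irrefl
    independent (inj₂ (inj₁ refl)) (inj₂ (inj₁ refl)) = Without-irrefl
    independent (inj₂ (inj₂ refl)) (inj₂ (inj₂ refl)) = Without-irrefl
    independent (inj₁ refl)        (inj₂ (inj₁ refl)) (_ , ¬same) = ¬same (inj₁ (refl , refl))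
    independent (inj₂ (inj₁ refl)) (inj₁ refl)        (_ , ¬same) = ¬same (inj₂ (refl , refl))
    independent (inj₁ refl)        (inj₂ (inj₂ refl)) = ¬adj-z p≤u ∘ proj₁
    independent (inj₂ (inj₁ refl)) (inj₂ (inj₂ refl)) = ¬adj-z q≤u ∘ proj₁
    independent (inj₂ (inj₂ refl)) (inj₁ refl)        = ¬adj-z p≤u ∘ Adjℕ-sym ∘ proj₁
    independent (inj₂ (inj₂ refl)) (inj₂ (inj₁ refl)) = ¬adj-z q≤u ∘ Adjℕ-sym ∘ proj₁

  colour∖pw : ℕ → ℕ → ℕ
  colour∖pw p x with x ≟ w | x ≟ z
  ... | yes _ | _     = p
  ... | no _  | yes _ = u
  ... | no _  | no _  = x

  deletion∖pw-colourable : ∀ {p} → p < u →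
    ∀ {G : Graph (5 + m)} → Represents G (Without Adjℕ p w) → StarColorable G (3 + m)
  deletion∖pw-colourable {p} p<u rep =
    starColorable-fromℕ rep (colour∖pw p) colour<w
      (isStarColouringℕ-byClasses (colour∖pw p) _ _ Without-irrefl collision
         S-independent T-independent T-sees-one-S)
    where
    p≤u : p ≤ u
    p≤u = <⇒≤ p<u

    colour<w : ∀ {x} → x < 5 + m → colour∖pw p x < w
    colour<w {x} x<n with x ≟ w | x ≟ z
    ... | yes _  | _      = <-trans p<u u<w
    ... | no _   | yes _  = u<w
    ... | no x≢w | no x≢z = below-w x<n x≢w x≢z

    collision : ∀ {x y} → x ≢ y → colour∖pw p x ≡ colour∖pw p y →
      ((x ≡ p ⊎ x ≡ w) × (y ≡ p ⊎ y ≡ w)) ⊎ ((x ≡ u ⊎ x ≡ z) × (y ≡ u ⊎ y ≡ z))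
    collision {x} {y} x≢y eq with x ≟ w | x ≟ z | y ≟ w | y ≟ z
    ... | yes refl | _        | yes refl | _        = ⊥-elim (x≢y refl)
    ... | yes refl | _        | no _     | yes refl = ⊥-elim (<⇒≢ p<u eq)
    ... | yes refl | _        | no _     | no _     = inj₁ (inj₂ refl , inj₁ (sym eq))
    ... | no _     | yes refl | yes refl | _        = ⊥-elim (<⇒≢ p<u (sym eq))
    ... | no _     | yes refl | no _     | yes refl = ⊥-elim (x≢y refl)
    ... | no _     | yes refl | no _     | no _     = inj₂ (inj₂ refl , inj₁ (sym eq))
    ... | no _     | no _     | yes refl | _        = inj₁ (inj₁ eq , inj₂ refl)
    ... | no _     | no _     | no _     | yes refl = inj₂ (inj₁ eq , inj₂ refl)
    ... | no _     | no _     | no _     | no _     = ⊥-elim (x≢y eq)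

    S-independent : ∀ {x y} → (x ≡ p ⊎ x ≡ w) → (y ≡ p ⊎ y ≡ w) → ¬ Without Adjℕ p w x y
    S-independent (inj₁ refl) (inj₁ refl) = Without-irrefl
    S-independent (inj₂ refl) (inj₂ refl) = Without-irrefl
    S-independent (inj₁ refl) (inj₂ refl) (_ , ¬same) = ¬same (inj₁ (refl , refl))
    S-independent (inj₂ refl) (inj₁ refl) (_ , ¬same) = ¬same (inj₂ (refl , refl))

    T-independent : ∀ {x y} → (x ≡ u ⊎ x ≡ z) → (y ≡ u ⊎ y ≡ z) → ¬ Without Adjℕ p w x y
    T-independent (inj₁ refl) (inj₁ refl) = Without-irrefl
    T-independent (inj₂ refl) (inj₂ refl) = Without-irrefl
    T-independent (inj₁ refl) (inj₂ refl) = ¬adj-z ≤-refl ∘ proj₁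
    T-independent (inj₂ refl) (inj₁ refl) = ¬adj-z ≤-refl ∘ Adjℕ-sym ∘ proj₁

    T-sees-one-S : ∀ {a b c} → (a ≡ p ⊎ a ≡ w) → (b ≡ u ⊎ b ≡ z) → (c ≡ p ⊎ c ≡ w) →
      a ≢ c → Without Adjℕ p w a b → Without Adjℕ p w b c → ⊥
    T-sees-one-S (inj₁ refl) _           (inj₁ refl) a≢c _  _  = a≢c refl
    T-sees-one-S (inj₂ refl) _           (inj₂ refl) a≢c _  _  = a≢c refl
    T-sees-one-S (inj₁ refl) (inj₁ refl) (inj₂ refl) _   _  uw = ¬adj-u-w (proj₁ uw)
    T-sees-one-S (inj₂ refl) (inj₁ refl) (inj₁ refl) _   wu _  = ¬adj-u-w (Adjℕ-sym (proj₁ wu))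
    T-sees-one-S (inj₁ refl) (inj₂ refl) (inj₂ refl) _   pz _  = ¬adj-z p≤u (proj₁ pz)
    T-sees-one-S (inj₂ refl) (inj₂ refl) (inj₁ refl) _   _  zp = ¬adj-z p≤u (Adjℕ-sym (proj₁ zp))

  colour∖wz : ℕ → ℕ
  colour∖wz x with x ≟ w | x ≟ z
  ... | yes _ | _     = u
  ... | no _  | yes _ = u
  ... | no _  | no _  = x

  deletion∖wz-colourable :
    ∀ {G : Graph (5 + m)} → Represents G (Without Adjℕ w z) → StarColorable G (3 + m)
  deletion∖wz-colourable rep =
    starColorable-fromℕ rep colour∖wz colour<w
      (isStarColouringℕ-byClass colour∖wz _ Without-irrefl collision independent)
    where
    colour<w : ∀ {x} → x < 5 + m → colour∖wz x < w
    colour<w {x} x<n with x ≟ w | x ≟ z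
    ... | yes _  | _      = u<w
    ... | no _   | yes _  = u<w
    ... | no x≢w | no x≢z = below-w x<n x≢w x≢z

    collision : ∀ {x y} → x ≢ y → colour∖wz x ≡ colour∖wz y →
      (x ≡ u ⊎ x ≡ w ⊎ x ≡ z) × (y ≡ u ⊎ y ≡ w ⊎ y ≡ z)
    collision {x} {y} x≢y eq with x ≟ w | x ≟ z | y ≟ w | y ≟ z
    ... | yes refl | _        | yes refl | _        = ⊥-elim (x≢y refl)
    ... | yes refl | _        | no _     | yes refl = inj₂ (inj₁ refl) , inj₂ (inj₂ refl)
    ... | yes refl | _        | no _     | no _     = inj₂ (inj₁ refl) , inj₁ (sym eq)
    ... | no _     | yes refl | yes refl | _        = inj₂ (inj₂ refl) , inj₂ (inj₁ refl)
    ... | no _     | yes refl | no _     | yes refl = ⊥-elim (x≢y refl)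
    ... | no _     | yes refl | no _     | no _     = inj₂ (inj₂ refl) , inj₁ (sym eq)
    ... | no _     | no _     | yes refl | _        = inj₁ eq , inj₂ (inj₁ refl)
    ... | no _     | no _     | no _     | yes refl = inj₁ eq , inj₂ (inj₂ refl)
    ... | no _     | no _     | no _     | no _     = ⊥-elim (x≢y eq)

    independent : ∀ {x y} → (x ≡ u ⊎ x ≡ w ⊎ x ≡ z) → (y ≡ u ⊎ y ≡ w ⊎ y ≡ z) →
      ¬ Without Adjℕ w z x y
    independent (inj₁ refl)        (inj₁ refl)        = Without-irrefl
    independent (inj₂ (inj₁ refl)) (inj₂ (inj₁ refl)) = Without-irrefl
    independent (inj₂ (inj₂ refl)) (inj₂ (inj₂ refl)) = Without-irrefl
    independent (inj₁ refl)        (inj₂ (inj₁ refl)) = ¬adj-u-w ∘ proj₁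
    independent (inj₂ (inj₁ refl)) (inj₁ refl)        = ¬adj-u-w ∘ Adjℕ-sym ∘ proj₁
    independent (inj₁ refl)        (inj₂ (inj₂ refl)) = ¬adj-z ≤-refl ∘ proj₁
    independent (inj₂ (inj₂ refl)) (inj₁ refl)        = ¬adj-z ≤-refl ∘ Adjℕ-sym ∘ proj₁
    independent (inj₂ (inj₁ refl)) (inj₂ (inj₂ refl)) (_ , ¬same) = ¬same (inj₁ (refl , refl))
    independent (inj₂ (inj₂ refl)) (inj₂ (inj₁ refl)) (_ , ¬same) = ¬same (inj₂ (refl , refl))

  H-needs : NeedsColours Adjℕ (4 + m)
  H-needs {k} {c} isStar = ≮⇒≥ no-colouring
    where
    open IsStarColouringℕ isStar

    no-colouring : ¬ k < z
    no-colouring k<z =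
      pigeonholeℕ k<z (c ∘ replace w z) (replace-injective c below-w-distinct z-distinct)
      where
      u-w-distinct : c u ≢ c w → ∀ {i j} → i < j → j < z → c i ≢ c j
      u-w-distinct u≁w {i} {j} i<j j<z with i ≟ u
      ... | no i≢u = proper (below-w-adj i<j (≤-pred j<z) i≢u)
      ... | yes refl with ≤-antisym (≤-pred j<z) i<j
      ...   | refl = u≁w

      u~w : c u ≡ c w
      u~w = decidable-stable (c u Fin.≟ c w) (λ u≁w → pigeonholeℕ k<z c (u-w-distinct u≁w))

      below-w-distinct : ∀ {x y} → x < y → y < z → x ≢ w → y ≢ w → c x ≢ c y
      below-w-distinct x<y y<z _ y≢w = proper (below-u-adj x<y (≤-pred (≤∧≢⇒< (≤-pred y<z) y≢w)))

      z-distinct : ∀ {x} → x < z → x ≢ w → c x ≢ c z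
      z-distinct {x} x<z x≢w with x ≟ u
      ... | yes refl = proper adj-w-z ∘ trans (sym u~w)
      ... | no x≢u   =
        noBicolouredPath (Adjℕ-sym (below-u-adj x<u ≤-refl)) (below-w-adj x<w ≤-refl x≢u) adj-w-z
          (<⇒≢ u<w) (<⇒≢ x<z) u~w
        where
        x<w : x < w
        x<w = ≤∧≢⇒< (≤-pred x<z) x≢w

        x<u : x < u
        x<u = ≤∧≢⇒< (≤-pred x<w) x≢u

  deletion-beyond-u-needs : ∀ {p q} → u < q → NeedsColours (Without Adjℕ p q) (3 + m)
  deletion-beyond-u-needs {p} {q} u<q {k} {c} isStar =
    ≮⇒≥ λ k<w → pigeonholeℕ k<w c λ i<j j<w →
      proper (below-u-adj i<j (≤-pred j<w) ,
              ¬SameEdge-avoidingʳ (<⇒≢ (<-trans i<j (below-q j<w))) (<⇒≢ (below-q j<w)))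
    where
    open IsStarColouringℕ isStar

    below-q : ∀ {j} → j < w → j < q
    below-q j<w = ≤-<-trans (≤-pred j<w) u<q

  deletion-u-needs : ∀ {p} → NeedsColours (Without Adjℕ p u) (3 + m)
  deletion-u-needs {p} {k} {c} isStar =
    ≮⇒≥ λ k<w → pigeonholeℕ k<w (c ∘ replace u w) (replace-injective c clique w-distinct)
    where
    open IsStarColouringℕ isStar

    clique : ∀ {x y} → x < y → y < w → x ≢ u → y ≢ u → c x ≢ c y
    clique x<y y<w x≢u y≢u = proper (below-u-adj x<y (≤-pred y<w) , ¬SameEdge-avoidingʳ x≢u y≢u)

    w-distinct : ∀ {x} → x < w → x ≢ u → c x ≢ c w
    w-distinct x<w x≢u =
      proper (below-w-adj x<w ≤-refl x≢u , ¬SameEdge-avoidingʳ x≢u (<⇒≢ u<w ∘ sym))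

  deletion-K-needs : ∀ {p q} → p < q → q < u → NeedsColours (Without Adjℕ p q) (3 + m)
  deletion-K-needs {p} {q} p<q q<u {k} {c} isStar = ≮⇒≥ λ k<w →
    noBicolouredPath p–u u–q q–w (<⇒≢ p<q) (<⇒≢ u<w) (p~q k<w) (u~w k<w)
    where
    open IsStarColouringℕ isStar

    p<u : p < u
    p<u = <-trans p<q q<u

    p–u : Without Adjℕ p q p u
    p–u = below-u-adj p<u ≤-refl , ¬SameEdge-avoidingʳ (<⇒≢ p<q) (<⇒≢ q<u ∘ sym)

    u–q : Without Adjℕ p q u q
    u–q = Adjℕ-sym (below-u-adj q<u ≤-refl) , ¬SameEdge-avoidingˡ (<⇒≢ p<u ∘ sym) (<⇒≢ p<q ∘ sym)

    q–w : Without Adjℕ p q q w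
    q–w = below-w-adj (<-trans q<u u<w) ≤-refl (<⇒≢ q<u) ,
          ¬SameEdge-avoidingˡ (<⇒≢ p<q ∘ sym) (<⇒≢ (<-trans p<u u<w) ∘ sym)

    p~q : k < w → c p ≡ c q
    p~q k<w = decidable-stable (c p Fin.≟ c q) λ p≁q → pigeonholeℕ k<w c (distinct p≁q)
      where
      distinct : c p ≢ c q → ∀ {i j} → i < j → j < w → c i ≢ c j
      distinct p≁q {i} {j} i<j j<w ci≡cj = proper (below-u-adj i<j (≤-pred j<w) , ¬same) ci≡cj
        where
        ¬same : ¬ SameEdge p q i j
        ¬same (inj₁ (refl , refl)) = p≁q ci≡cj
        ¬same (inj₂ (refl , refl)) = <-asym p<q i<j

    u~w : k < w → c u ≡ c w
    u~w k<w = decidable-stable (c u Fin.≟ c w) λ u≁w →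
      pigeonholeℕ k<w (c ∘ replace q w) (replace-injective c clique (w-distinct u≁w))
      where
      clique : ∀ {x y} → x < y → y < w → x ≢ q → y ≢ q → c x ≢ c y
      clique x<y y<w x≢q y≢q = proper (below-u-adj x<y (≤-pred y<w) , ¬SameEdge-avoidingʳ x≢q y≢q)

      w-distinct : c u ≢ c w → ∀ {x} → x < w → x ≢ q → c x ≢ c w
      w-distinct u≁w {x} x<w x≢q with x ≟ u
      ... | yes refl = u≁w
      ... | no x≢u   = proper (below-w-adj x<w ≤-refl x≢u ,
                               ¬SameEdge-avoidingʳ x≢q (<⇒≢ (<-trans q<u u<w) ∘ sym))

  deletion-critical : ∀ {p q} → Edgeℕ p q →
    ∀ {G : Graph (5 + m)} → Represents G (Without Adjℕ p q) → StarChromatic G (3 + m)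
  deletion-critical (inj₂ (refl , refl)) rep =
    starChromatic rep (deletion∖wz-colourable rep) (deletion-beyond-u-needs u<z)
  deletion-critical (inj₁ (p<q , p≤1+m , q≤w)) rep with m≤n⇒m<n∨m≡n q≤w
  ... | inj₂ refl =
    starChromatic rep (deletion∖pw-colourable (s≤s p≤1+m) rep) (deletion-beyond-u-needs u<w)
  ... | inj₁ q<w with m≤n⇒m<n∨m≡n (≤-pred q<w)
  ...   | inj₂ refl = starChromatic rep (deletion∖pq-colourable p<q ≤-refl rep) deletion-u-needs
  ...   | inj₁ q<u  =
    starChromatic rep (deletion∖pq-colourable p<q (<⇒≤ q<u) rep) (deletion-K-needs p<q q<u)

  H-critical : Critical (H (5 + m)) (4 + m)
  H-critical =
    starChromatic H-represented H-colourable H-needs ,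
    λ a b ab → 3 + m , ≤-refl , deletion a b (to H-represented ab)
    where
    deletion : ∀ a b → Adjℕ (toℕ a) (toℕ b) → StarChromatic (H (5 + m) -edge (a , b)) (3 + m)
    deletion a b (inj₁ e) = deletion-critical e (without-represented H-represented a b)
    deletion a b (inj₂ e) = deletion-critical e
      (represents-resp (without-represented H-represented a b)
        (without-swap {R = Adjℕ}) (without-swap {R = Adjℕ}))

mainTheorem10 : (n : ℕ) → 5 ≤ n → Critical (H n) (n ∸ 1)
mainTheorem10 _ (s≤s (s≤s (s≤s (s≤s (s≤s (z≤n {m})))))) = H-critical m
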